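{- Let $\mathcal{Q}$ and $\mathcal{Q}'$ be seminormal quasi-crystals of the same type, with underlying sets $Q,Q'$, and let $\psi:\mathcal{Q}\to\mathcal{Q}'$ be a quasi-crystal homomorphism such that $\psi:Q\sqcup\{\bot\}\to Q'\sqcup\{\bot\}$ is bijective. Then $\psi$ is a quasi-crystal isomorphism.
   Context: Root system data: $V$ a finite-dimensional real inner product space, $\alpha^\vee=\frac{2}{\langle\alpha,\alpha\rangle}\alpha$; a root system $\Phi$ with fixed simple roots $(\alpha_i)_{i\in I}$ and weight lattice $\Lambda$ (a $\mathbb{Z}$-submodule of $V$ spanning $V$, containing $\Phi$, with $\langle\lambda,\alpha^\vee\rangle\in\mathbb{Z}$ for $\alpha\in\Phi$). A quasi-crystal of type $\Phi$ is a set $Q$ with maps $\mathrm{wt}:Q\to\Lambda$, $\ddot{e}_i,\ddot{f}_i:Q\to Q\sqcup\{\bot\}$ ($\bot$ = undefined), $\ddot{\varepsilon}_i,\ddot{\varphi}_i:Q\to\mathbb{Z}\cup\{\pm\infty\}$ ($i\in I$) such that for all $x,y$: $\ddot{\varphi}_i(x)=\ddot{\varepsilon}_i(x)+\langle\mathrm{wt}(x),\alpha_i^\vee\rangle$ (with $m+(\pm\infty)=\pm\infty$); if $\ddot{e}_i(x)\in Q$ then $\mathrm{wt}(\ddot{e}_i(x))=\mathrm{wt}(x)+\alpha_i$, $\ddot{\varepsilon}_i(\ddot{e}_i(x))=\ddot{\varepsilon}_i(x)-1$, $\ddot{\varphi}_i(\ddot{e}_i(x))=\ddot{\varphi}_i(x)+1$;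 if $\ddot{f}_i(x)\in Q$ then $\mathrm{wt}(\ddot{f}_i(x))=\mathrm{wt}(x)-\alpha_i$, $\ddot{\varepsilon}_i(\ddot{f}_i(x))=\ddot{\varepsilon}_i(x)+1$, $\ddot{\varphi}_i(\ddot{f}_i(x))=\ddot{\varphi}_i(x)-1$; $\ddot{e}_i(x)=y\iff x=\ddot{f}_i(y)$; $\ddot{\varepsilon}_i(x)=\pm\infty$ implies $\ddot{e}_i(x)=\ddot{f}_i(x)=\bot$. It is seminormal if whenever $\ddot{\varepsilon}_i(x)\ne+\infty$, $\ddot{\varepsilon}_i(x)=\max\{k\ge0:\ddot{e}_i^k(x)\in Q\}$ and $\ddot{\varphi}_i(x)=\max\{k\ge0:\ddot{f}_i^k(x)\in Q\}$ (operators composed as partial maps). A quasi-crystal homomorphism $\psi:\mathcal{Q}\to\mathcal{Q}'$ is a map $\psi:Q\sqcup\{\bot\}\to Q'\sqcup\{\bot\}$ with $\psi(\bot)=\bot$ such that for all $x\in Q$, $i\in I$: if $\psi(x)\in Q'$ then $\mathrm{wt}(\psi(x))=\mathrm{wt}(x)$, $\ddot{\varepsilon}_i(\psi(x))=\ddot{\varepsilon}_i(x)$, $\ddot{\varphi}_i(\psi(x))=\ddot{\varphi}_i(x)$; if $\ddot{e}_i(x)\in Q$ and $\psi(x),\psi(\ddot{e}_i(x))\in Q'$ then $\psi(\ddot{e}_i(x))=\ddot{e}_i(\psi(x))$; if $\ddot{f}_i(x)\in Q$ and $\psi(x),\psi(\ddot{f}_i(x))\in Q'$ then $\psi(\ddot{f}_i(x))=\ddot{f}_i(\psi(x))$.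 A quasi-crystal isomorphism is a bijection $\psi:Q\sqcup\{\bot\}\to Q'\sqcup\{\bot\}$ such that $\psi$ and $\psi^{ -1}$ are quasi-crystal homomorphisms. -}

module Defs where

open import Data.Nat using (ℕ; _≤_)
open import Data.Integer using (ℤ; +_; -[1+_]) renaming (_+_ to _+ℤ_)
open import Data.Maybe using (Maybe; just; nothing; Is-just)
open import Data.Product using (Σ; _×_)
open import Relation.Binary.PropositionalEquality using (_≡_; _≢_)
open import Function.Definitions using (Bijective)

-- I : index set of simple roots, Λ : weight lattice,
-- α i : simple root α_i ∈ Λ, pair λ i = ⟨λ , α_i^∨⟩ ∈ ℤ.

record RootDatum : Set₁ where
  field
    I    : Set
    Λ    : Set
    _+Λ_ : Λ → Λ → Λ
    _-Λ_ : Λ → Λ → Λ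
    α    : I → Λ
    pair : Λ → I → ℤ

data ℤ∞ : Set where
  fin : ℤ → ℤ∞
  +∞  : ℤ∞
  -∞  : ℤ∞

_+∞ℤ_ : ℤ∞ → ℤ → ℤ∞
fin a +∞ℤ m = fin (a +ℤ m)
+∞    +∞ℤ m = +∞
-∞    +∞ℤ m = -∞

suc∞ pred∞ : ℤ∞ → ℤ∞
suc∞  x = x +∞ℤ (+ 1)
pred∞ x = x +∞ℤ -[1+ 0 ]

-- Partial maps Q → Q ⊔ {⊥}, modelled with Maybe (nothing = ⊥).

iter : {Q : Set} → ℕ → (Q → Maybe Q) → Maybe Q → Maybe Q
iter ℕ.zero    g m = m
iter (ℕ.suc k) g nothing  = nothing
iter (ℕ.suc k) g (just x) = iter k g (g x)

IsMaxDefined : {Q : Set} → (Q → Maybe Q) → Q → ℕ → Set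
IsMaxDefined g x n =
  Is-just (iter n g (just x)) × (∀ k → Is-just (iter k g (just x)) → k ≤ n)

module _ (D : RootDatum) where
  open RootDatum D

  record QuasiCrystal : Set₁ where
    field
      Q   : Set
      wt  : Q → Λ
      e f : I → Q → Maybe Q
      ε φ : I → Q → ℤ∞
      φ-def   : ∀ i x → φ i x ≡ (ε i x +∞ℤ pair (wt x) i)
      e-wt    : ∀ i x y → e i x ≡ just y → wt y ≡ (wt x +Λ α i)
      e-ε     : ∀ i x y → e i x ≡ just y → ε i y ≡ pred∞ (ε i x)
      e-φ     : ∀ i x y → e i x ≡ just y → φ i y ≡ suc∞ (φ i x)
      f-wt    : ∀ i x y → f i x ≡ just y → wt y ≡ (wt x -Λ α i)
      f-ε     : ∀ i x y → f i x ≡ just y → ε i y ≡ suc∞ (ε i x)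
      f-φ     : ∀ i x y → f i x ≡ just y → φ i y ≡ pred∞ (φ i x)
      e→f     : ∀ i x y → e i x ≡ just y → f i y ≡ just x
      f→e     : ∀ i x y → f i y ≡ just x → e i x ≡ just y
      +∞-e    : ∀ i x → ε i x ≡ +∞ → e i x ≡ nothing × f i x ≡ nothing
      -∞-e    : ∀ i x → ε i x ≡ -∞ → e i x ≡ nothing × f i x ≡ nothing

  IsSeminormal : QuasiCrystal → Set
  IsSeminormal 𝒬 = ∀ i x → ε i x ≢ +∞ →
      Σ ℕ (λ n → ε i x ≡ fin (+ n) × IsMaxDefined (e i) x n)
    × Σ ℕ (λ n → φ i x ≡ fin (+ n) × IsMaxDefined (f i) x n)
    where open QuasiCrystal 𝒬

  module _ (𝒬 𝒬' : QuasiCrystal) where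
    private
      module A = QuasiCrystal 𝒬
      module B = QuasiCrystal 𝒬'

    IsHomomorphism : (Maybe A.Q → Maybe B.Q) → Set
    IsHomomorphism ψ =
        ψ nothing ≡ nothing
      × (∀ x y → ψ (just x) ≡ just y →
            B.wt y ≡ A.wt x
          × (∀ i → B.ε i y ≡ A.ε i x)
          × (∀ i → B.φ i y ≡ A.φ i x))
      × (∀ i x x' y y' → A.e i x ≡ just x' → ψ (just x) ≡ just y →
            ψ (just x') ≡ just y' → B.e i y ≡ just y')
      × (∀ i x x' y y' → A.f i x ≡ just x' → ψ (just x) ≡ just y →
            ψ (just x') ≡ just y' → B.f i y ≡ just y')

  IsIsomorphism : (𝒬 𝒬' : QuasiCrystal) →
    (Maybe (QuasiCrystal.Q 𝒬) → Maybe (QuasiCrystal.Q 𝒬')) → Set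
  IsIsomorphism 𝒬 𝒬' ψ =
    Σ (Maybe (QuasiCrystal.Q 𝒬') → Maybe (QuasiCrystal.Q 𝒬)) λ ψ⁻¹ →
        (∀ a → ψ⁻¹ (ψ a) ≡ a)
      × (∀ b → ψ (ψ⁻¹ b) ≡ b)
      × IsHomomorphism 𝒬 𝒬' ψ
      × IsHomomorphism 𝒬' 𝒬 ψ⁻¹

-- The inverse map ψ⁻¹ transports wt, εᵢ and φᵢ back for free; what needs proof is
-- that it commutes with ëᵢ and f̈ᵢ, i.e. that ψ reflects arrows: ëᵢ(ψ x) = ψ x'
-- implies ëᵢ x = x'. By seminormality ëᵢ is defined at a point exactly when εᵢ is a
-- positive integer there, and ψ preserves εᵢ, so ëᵢ x is defined; since ψ commutes
-- with ëᵢ and is injective, ëᵢ x = x'. For f̈ᵢ the same argument runs through φᵢ.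
module Submission where

open import Defs
open import Data.Maybe using (Maybe; just; nothing; Is-just)
open import Data.Maybe.Relation.Unary.Any using (just)
open import Data.Nat using (zero; suc; _≤_; s≤s)
open import Data.Integer using (+_)
open import Data.Product using (∃; _×_; _,_; proj₁; proj₂)
open import Data.Unit using (tt)
open import Relation.Nullary using (¬_; contradiction)
open import Relation.Binary.PropositionalEquality
open import Function.Definitions using (Injective; Bijective)
open import Function.Bundles using (Inverse; mk⤖)
open import Function.Properties.Bijection using (⤖⇒↔)

module _ {Q : Set} {g : Q → Maybe Q} {x : Q} where

  ¬Is-just-iter-nothing : ∀ k → ¬ Is-just (iter k g nothing)
  ¬Is-just-iter-nothing zero    ()
  ¬Is-just-iter-nothing (suc k) ()

  IsMaxDefined-defined⇒1≤ : ∀ {n y} → IsMaxDefined g x n → g x ≡ just y → 1 ≤ n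
  IsMaxDefined-defined⇒1≤ (_ , maximal) gx≡y = maximal 1 (subst Is-just (sym gx≡y) (just tt))

  IsMaxDefined-suc⇒defined : ∀ {n} → IsMaxDefined g x (suc n) → ∃ λ y → g x ≡ just y
  IsMaxDefined-suc⇒defined {n} (defined , _) with g x
  ... | just y  = y , refl
  ... | nothing = contradiction defined (¬Is-just-iter-nothing n)

fin-+-injective : ∀ {m n} → fin (+ m) ≡ fin (+ n) → m ≡ n
fin-+-injective refl = refl

fin≢+∞ : ∀ {a} → fin a ≢ +∞
fin≢+∞ ()

module SeminormalProperties {D : RootDatum} (𝒬 : QuasiCrystal D) (seminormal : IsSeminormal D 𝒬) where
  open RootDatum D using (pair)
  open QuasiCrystal 𝒬

  e-defined⇒ε-finite : ∀ {i x y} → e i x ≡ just y → ε i x ≢ +∞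
  e-defined⇒ε-finite {i} {x} ex≡y ε≡+∞ with trans (sym ex≡y) (proj₁ (+∞-e i x ε≡+∞))
  ... | ()

  f-defined⇒ε-finite : ∀ {i x y} → f i x ≡ just y → ε i x ≢ +∞
  f-defined⇒ε-finite {i} {x} fx≡y ε≡+∞ with trans (sym fx≡y) (proj₂ (+∞-e i x ε≡+∞))
  ... | ()

  e-defined⇒ε-positive : ∀ {i x y} → e i x ≡ just y → ∃ λ n → ε i x ≡ fin (+ suc n)
  e-defined⇒ε-positive {i} {x} ex≡y
    with proj₁ (seminormal i x (e-defined⇒ε-finite ex≡y))
  ... | n , ε≡n , maximal with IsMaxDefined-defined⇒1≤ maximal ex≡y
  ... | s≤s _ = _ , ε≡n

  f-defined⇒φ-positive : ∀ {i x y} → f i x ≡ just y → ∃ λ n → φ i x ≡ fin (+ suc n)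
  f-defined⇒φ-positive {i} {x} fx≡y
    with proj₂ (seminormal i x (f-defined⇒ε-finite fx≡y))
  ... | n , φ≡n , maximal with IsMaxDefined-defined⇒1≤ maximal fx≡y
  ... | s≤s _ = _ , φ≡n

  ε-positive⇒e-defined : ∀ {i x n} → ε i x ≡ fin (+ suc n) → ∃ λ y → e i x ≡ just y
  ε-positive⇒e-defined {i} {x} ε≡sn
    with proj₁ (seminormal i x λ ε≡+∞ → fin≢+∞ (trans (sym ε≡sn) ε≡+∞))
  ... | m , ε≡m , maximal =
    IsMaxDefined-suc⇒defined (subst (IsMaxDefined (e i) x) (fin-+-injective (trans (sym ε≡m) ε≡sn)) maximal)

  φ-finite⇒ε-finite : ∀ {i x a} → φ i x ≡ fin a → ε i x ≢ +∞
  φ-finite⇒ε-finite {i} {x} φ≡a ε≡+∞ =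
    fin≢+∞ (trans (sym φ≡a) (trans (φ-def i x) (cong (_+∞ℤ pair (wt x) i) ε≡+∞)))

  φ-positive⇒f-defined : ∀ {i x n} → φ i x ≡ fin (+ suc n) → ∃ λ y → f i x ≡ just y
  φ-positive⇒f-defined {i} {x} φ≡sn
    with proj₂ (seminormal i x (φ-finite⇒ε-finite φ≡sn))
  ... | m , φ≡m , maximal =
    IsMaxDefined-suc⇒defined (subst (IsMaxDefined (f i) x) (fin-+-injective (trans (sym φ≡m) φ≡sn)) maximal)

module _ {A B : Set} where

  Commutes : (Maybe A → Maybe B) → (A → Maybe A) → (B → Maybe B) → Set
  Commutes ψ g h = ∀ x x' y y' → g x ≡ just x' → ψ (just x) ≡ just y → ψ (just x') ≡ just y' → h y ≡ just y'

  Reflects : (Maybe A → Maybe B) → (A → Maybe A) → (B → Maybe B) → Set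
  Reflects ψ g h = ∀ {x x' y y'} → ψ (just x) ≡ just y → ψ (just x') ≡ just y' → h y ≡ just y' → g x ≡ just x'

module _ {A B : Set} {ψ : Maybe A → Maybe B}
         (ψ-injective : Injective _≡_ _≡_ ψ) (ψ-nothing : ψ nothing ≡ nothing) where

  injective-just-defined : ∀ x → ∃ λ y → ψ (just x) ≡ just y
  injective-just-defined x with ψ (just x) in ψx≡
  ... | just y  = y , refl
  ... | nothing = contradiction (ψ-injective (trans ψx≡ (sym ψ-nothing))) λ ()

  commutes⇒reflects : ∀ {g h} → Commutes ψ g h →
    (∀ {x y y'} → ψ (just x) ≡ just y → h y ≡ just y' → ∃ λ x'' → g x ≡ just x'') →
    Reflects ψ g h
  commutes⇒reflects {h = h} commutes defined {x} {x'} {y} {y'} ψx≡y ψx'≡y' hy≡y' =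
    trans gx≡x'' (ψ-injective (begin
      ψ (just x'') ≡⟨ ψx''≡z ⟩
      just z       ≡⟨ sym (commutes x x'' y z gx≡x'' ψx≡y ψx''≡z) ⟩
      h y          ≡⟨ hy≡y' ⟩
      just y'      ≡⟨ sym ψx'≡y' ⟩
      ψ (just x')  ∎))
    where
      open ≡-Reasoning
      x'' = proj₁ (defined ψx≡y hy≡y')
      gx≡x'' = proj₂ (defined ψx≡y hy≡y')
      z = proj₁ (injective-just-defined x'')
      ψx''≡z = proj₂ (injective-just-defined x'')

module InverseOfBijection {A B : Set} {ψ : Maybe A → Maybe B} (bijective : Bijective _≡_ _≡_ ψ) where
  open Inverse (⤖⇒↔ (mk⤖ bijective)) public using (from; strictlyInverseˡ; strictlyInverseʳ)

  from-just : ∀ {x y} → from (just y) ≡ just x → ψ (just x) ≡ just y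
  from-just {y = y} from-y≡x = trans (cong ψ (sym from-y≡x)) (strictlyInverseˡ (just y))

  from-nothing : ψ nothing ≡ nothing → from nothing ≡ nothing
  from-nothing ψ-nothing = trans (cong from (sym ψ-nothing)) (strictlyInverseʳ nothing)

  reflects⇒from-commutes : ∀ {g h} → Reflects ψ g h → Commutes from h g
  reflects⇒from-commutes reflects y y' x x' hy≡y' from-y≡x from-y'≡x' =
    reflects (from-just from-y≡x) (from-just from-y'≡x') hy≡y'

module _ {D : RootDatum} (𝒬 𝒬' : QuasiCrystal D)
         (seminormal : IsSeminormal D 𝒬) (seminormal' : IsSeminormal D 𝒬')
         (ψ : Maybe (QuasiCrystal.Q 𝒬) → Maybe (QuasiCrystal.Q 𝒬'))
         (ψ-hom : IsHomomorphism D 𝒬 𝒬' ψ) (ψ-injective : Injective _≡_ _≡_ ψ) where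
  private
    module A = QuasiCrystal 𝒬
    module B = QuasiCrystal 𝒬'
    module SA = SeminormalProperties 𝒬 seminormal
    module SB = SeminormalProperties 𝒬' seminormal'
    ψ-nothing = proj₁ ψ-hom
    ψ-values = proj₁ (proj₂ ψ-hom)
    ψ-e = proj₁ (proj₂ (proj₂ ψ-hom))
    ψ-f = proj₂ (proj₂ (proj₂ ψ-hom))

  e-defined-reflected : ∀ {i x y y'} → ψ (just x) ≡ just y → B.e i y ≡ just y' →
    ∃ λ x'' → A.e i x ≡ just x''
  e-defined-reflected {i} {x} {y} ψx≡y ey≡y' =
    SA.ε-positive⇒e-defined (trans (sym εy≡εx) (proj₂ (SB.e-defined⇒ε-positive ey≡y')))
    where εy≡εx = proj₁ (proj₂ (ψ-values x y ψx≡y)) i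

  f-defined-reflected : ∀ {i x y y'} → ψ (just x) ≡ just y → B.f i y ≡ just y' →
    ∃ λ x'' → A.f i x ≡ just x''
  f-defined-reflected {i} {x} {y} ψx≡y fy≡y' =
    SA.φ-positive⇒f-defined (trans (sym φy≡φx) (proj₂ (SB.f-defined⇒φ-positive fy≡y')))
    where φy≡φx = proj₂ (proj₂ (ψ-values x y ψx≡y)) i

  inverse-isHomomorphism : (bijective : Bijective _≡_ _≡_ ψ) →
    IsHomomorphism D 𝒬' 𝒬 (InverseOfBijection.from bijective)
  inverse-isHomomorphism bijective =
      from-nothing ψ-nothing
    , from-values
    , (λ i → reflects⇒from-commutes (commutes⇒reflects ψ-injective ψ-nothing (ψ-e i) e-defined-reflected))
    , (λ i → reflects⇒from-commutes (commutes⇒reflects ψ-injective ψ-nothing (ψ-f i) f-defined-reflected))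
    where
      open InverseOfBijection bijective
      from-values : ∀ y x → from (just y) ≡ just x →
        A.wt x ≡ B.wt y × (∀ i → A.ε i x ≡ B.ε i y) × (∀ i → A.φ i x ≡ B.φ i y)
      from-values y x from-y≡x =
        let wt≡ , ε≡ , φ≡ = ψ-values x y (from-just from-y≡x)
        in sym wt≡ , (λ i → sym (ε≡ i)) , (λ i → sym (φ≡ i))

corollary3p18 : (D : RootDatum) (𝒬 𝒬' : QuasiCrystal D) →
    IsSeminormal D 𝒬 → IsSeminormal D 𝒬' →
    (ψ : Maybe (QuasiCrystal.Q 𝒬) → Maybe (QuasiCrystal.Q 𝒬')) →
    IsHomomorphism D 𝒬 𝒬' ψ →
    Bijective _≡_ _≡_ ψ →
    IsIsomorphism D 𝒬 𝒬' ψ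
corollary3p18 D 𝒬 𝒬' seminormal seminormal' ψ ψ-hom bijective@(ψ-injective , _) =
    from , strictlyInverseʳ , strictlyInverseˡ , ψ-hom
  , inverse-isHomomorphism 𝒬 𝒬' seminormal seminormal' ψ ψ-hom ψ-injective bijective
  where open InverseOfBijection bijective
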